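{- Let $k\in\mathbb{N}$ with $k\ge2$, and let $\mathbf{X},\mathbf{A}$ be two finite $k$-enhanced $\sigma$-structures with $X=[k]$. Then: (1) if there is no homomorphism $\mathbf{X}^{\otimes k}\to\mathbb{F}_{\mathscr{Q}_{\mathrm{conv}}}(\mathbf{A}^{\otimes k})$, then $|\mathrm{Hom}(\mathbf{X},\mathbf{A})|=0$; (2) if $g:\mathbf{X}^{\otimes k}\to\mathbb{F}_{\mathscr{Q}_{\mathrm{conv}}}(\mathbf{A}^{\otimes k})$ is a homomorphism of maximum support, then $|\mathrm{Hom}(\mathbf{X},\mathbf{A})|=|\mathrm{supp}(g((1,\dots,k)))|$.
   Context: A $\sigma$-structure $\mathbf{A}$ has domain $A$ and relations $R^{\mathbf{A}}\subseteq A^{\mathrm{ar}(R)}$; homomorphisms preserve all relations coordinatewise; $\mathrm{Hom}(\mathbf{X},\mathbf{A})$ is the set of homomorphisms $\mathbf{X}\to\mathbf{A}$. For $\mathbf{x}=(x_1,\dots,x_r)$ and $\mathbf{i}=(i_1,\dots,i_\ell)\in[r]^\ell$, $\mathbf{x}_{\mathbf{i}}=(x_{i_1},\dots,x_{i_\ell})$. A $\sigma$-structure is $k$-enhanced if $\sigma$ contains a $k$-ary symbol $R_k$ with $R_k^{\mathbf{A}}=A^k$. Tensor power: $\mathbf{A}^{\otimes k}$ has the same symbols, where $R$ of arity $r$ gets arity $r^k$ with positions indexed by $[r]^k$; domain $A^k$; $R^{\mathbf{A}^{\otimes k}}=\{\mathbf{a}^{\otimes k}:\mathbf{a}\in R^{\mathbf{A}}\}$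 with $\mathbf{a}^{\otimes k}$ the family whose $\mathbf{i}$-th entry is $\mathbf{a}_{\mathbf{i}}\in A^k$. Maps are applied to such families entrywise. $\mathbb{F}_{\mathscr{Q}_{\mathrm{conv}}}(\mathbf{A}^{\otimes k})$: domain is the set of nonnegative rational tensors indexed by $A^k$ with entries summing to $1$; a family $(M_{\mathbf{i}})_{\mathbf{i}\in[r]^k}$ is in $R^{\mathbb{F}_{\mathscr{Q}_{\mathrm{conv}}}(\mathbf{A}^{\otimes k})}$ iff there is a rational probability vector $q$ on $R^{\mathbf{A}}$ with $M_{\mathbf{i}}(\mathbf{a})=\sum_{\mathbf{b}\in R^{\mathbf{A}},\,\mathbf{b}_{\mathbf{i}}=\mathbf{a}}q(\mathbf{b})$ for all $\mathbf{i}\in[r]^k$, $\mathbf{a}\in A^k$. The support $\mathrm{supp}(T)$ of a tensor $T$ is the set of indices of its nonzero entries. A homomorphism $g:\mathbf{X}^{\otimes k}\to\mathbb{F}_{\mathscr{Q}_{\mathrm{conv}}}(\mathbf{A}^{\otimes k})$ has maximum support if $\mathrm{supp}(g(\mathbf{x}))\supseteq\mathrm{supp}(g'(\mathbf{x}))$ for every homomorphism $g':\mathbf{X}^{\otimes k}\to\mathbb{F}_{\mathscr{Q}_{\mathrm{conv}}}(\mathbf{A}^{\otimes k})$ and every $\mathbf{x}\in X^k$. -}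

module Defs where

open import Data.Nat using (ℕ; zero; suc)
open import Data.Fin using (Fin; _≟_)
open import Data.Fin.Properties renaming (all? to allFin?) using ()
open import Data.Vec using (Vec; []; _∷_; lookup)
import Data.Vec as V
open import Data.Vec.Properties using (≡-dec)
open import Data.List using (List; [_]; concatMap; filter; length; allFin; foldr)
import Data.List as L
open import Data.List.Relation.Unary.All using (All; all?)
open import Data.List.Membership.Propositional using (_∈_)
import Data.List.Membership.DecPropositional as DecMem
open import Data.Rational using (ℚ; 0ℚ; 1ℚ; _+_; _≤_)
open import Data.Product using (Σ; _×_; _,_)
open import Relation.Nullary using (Dec; ¬_; ¬?)
open import Relation.Binary.PropositionalEquality using (_≡_; _≢_)
import Data.Rational.Properties as ℚP

record Signature : Set where
  field
    nsym : ℕ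
    ar   : Fin nsym → ℕ
open Signature public

-- A finite σ-structure with domain Fin n; each relation is given as a finite
-- list of tuples (the relation is the set of tuples occurring in the list).
record Structure (σ : Signature) (n : ℕ) : Set where
  field
    rel : (s : Fin (nsym σ)) → List (Vec (Fin n) (ar σ s))
open Structure public

allVecs : (n k : ℕ) → List (Vec (Fin n) k)
allVecs n zero    = [ [] ]
allVecs n (suc k) = concatMap (λ a → L.map (a ∷_) (allVecs n k)) (allFin n)

_at_ : ∀ {D : Set} {r ℓ} → Vec D r → Vec (Fin r) ℓ → Vec D ℓ
x at i = V.map (lookup x) i

Enhanced : ∀ {σ nX nA} (k : ℕ) → Structure σ nX → Structure σ nA → Set
Enhanced {σ} {nX} {nA} k X A =
  Σ (Fin (nsym σ)) λ s → (ar σ s ≡ k)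
    × (∀ (t : Vec (Fin nX) (ar σ s)) → t ∈ rel X s)
    × (∀ (t : Vec (Fin nA) (ar σ s)) → t ∈ rel A s)

IsHom : ∀ {σ nX nA} → Structure σ nX → Structure σ nA → Vec (Fin nA) nX → Set
IsHom {σ} X A h = ∀ s → All (λ t → h at t ∈ rel A s) (rel X s)

isHom? : ∀ {σ nX nA} (X : Structure σ nX) (A : Structure σ nA) (h : Vec (Fin nA) nX) → Dec (IsHom X A h)
isHom? {σ} X A h = allFin? (λ s → all? (λ t → DecMem._∈?_ (≡-dec _≟_) (h at t) (rel A s)) (rel X s))

countHom : ∀ {σ nX nA} → Structure σ nX → Structure σ nA → ℕ
countHom {σ} {nX} {nA} X A = length (filter (isHom? X A) (allVecs nA nX))

Tensor : ℕ → ℕ → Set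
Tensor n k = Vec (Fin n) k → ℚ

sumℚ : List ℚ → ℚ
sumℚ = foldr _+_ 0ℚ

-- domain of F_{Q_conv}(A^{⊗k}): nonnegative tensors with entries summing to 1
IsProbTensor : ∀ {n k} → Tensor n k → Set
IsProbTensor {n} {k} T = (∀ a → 0ℚ ≤ T a) × sumℚ (L.map T (allVecs n k)) ≡ 1ℚ

-- membership of a family (M_i)_{i ∈ [r]^k} in R_s^{F_{Q_conv}(A^{⊗k})}.
-- q is a rational probability vector on R_s^A, represented as a function on
-- all of A^r that vanishes outside R_s^A.
InConvRel : ∀ {σ nA} (A : Structure σ nA) (k : ℕ) (s : Fin (nsym σ))
  → (Vec (Fin (ar σ s)) k → Tensor nA k) → Set
InConvRel {σ} {nA} A k s M =
  Σ (Vec (Fin nA) (ar σ s) → ℚ) λ q →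
      (∀ b → 0ℚ ≤ q b)
    × (∀ b → q b ≢ 0ℚ → b ∈ rel A s)
    × (sumℚ (L.map q (allVecs nA (ar σ s))) ≡ 1ℚ)
    × (∀ (i : Vec (Fin (ar σ s)) k) (a : Vec (Fin nA) k) →
         M i a ≡ sumℚ (L.map q (filter (λ b → ≡-dec _≟_ (b at i) a) (allVecs nA (ar σ s)))))

IsConvHom : ∀ {σ nX nA} (k : ℕ) → Structure σ nX → Structure σ nA
  → (Vec (Fin nX) k → Tensor nA k) → Set
IsConvHom {σ} k X A g =
    (∀ x → IsProbTensor (g x))
  × (∀ s (t : Vec _ (ar σ s)) → t ∈ rel X s → InConvRel A k s (λ i → g (t at i)))

supp⊇ : ∀ {n k} → Tensor n k → Tensor n k → Set
supp⊇ T T' = ∀ a → T' a ≢ 0ℚ → T a ≢ 0ℚ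

MaxSupport : ∀ {σ nX nA} (k : ℕ) → Structure σ nX → Structure σ nA
  → (Vec (Fin nX) k → Tensor nA k) → Set
MaxSupport k X A g =
  ∀ g' → IsConvHom k X A g' → ∀ x → supp⊇ (g x) (g' x)

suppSize : ∀ {n k} → Tensor n k → ℕ
suppSize {n} {k} T = length (filter (λ a → ¬? (T a ℚP.≟ 0ℚ)) (allVecs n k))

{-# OPTIONS --safe #-}
module Submission where

-- A homomorphism h : X → A yields the point-mass homomorphism x ↦ δ_{h∘x} into
-- F(A^{⊗k}); this gives (1) and puts every h into the support of a maximum-support g
-- at the identity tuple id = (1,…,k). Conversely, id ∈ R_k^X, so g is the family of
-- marginals g(i) of a single distribution q on A^k, and g(id)(h) ≠ 0 means q(h) ≠ 0.
-- For t ∈ R^X with witness distribution p on R^A, the marginals of p along i ∈ [r]^k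
-- equal those of q along t∘i, so their supports project onto each other. Choosing i a
-- section of t yields b ∈ supp p agreeing with h∘t on the image of the section, and
-- since k ≥ 2 every b ∈ supp p is constant on the fibres of t; hence b = h∘t ∈ R^A.

open import Defs
open import Data.Nat using (ℕ; zero; suc; _≤_; s≤s)
open import Data.Fin as F using (Fin; _≟_)
import Data.Fin.Properties as FinP
open import Data.Vec as V using (Vec; []; _∷_; lookup; tabulate)
open import Data.Vec.Properties
  using (≡-dec; lookup-map; lookup∘tabulate; map-∘; map-cong; map-id; map-lookup-allFin;
         ∷-injective; ∷-injectiveˡ; ∷-injectiveʳ)
open import Data.Vec.Relation.Binary.Pointwise.Extensional using (ext; Pointwise-≡⇒≡)
open import Data.List as L using (List; []; _∷_; filter; length; allFin; cartesianProductWith)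
open import Data.List.Properties using (filter-none; filter-≐)
import Data.List.Relation.Unary.All as All
open import Data.List.Relation.Unary.All.Properties using (All¬⇒¬Any)
open import Data.List.Relation.Unary.Any using (here; there)
open import Data.List.Relation.Unary.AllPairs using ([]; _∷_)
open import Data.List.Membership.Propositional using (_∈_; _∉_)
open import Data.List.Membership.Propositional.Properties
  using (∈-allFin; ∈-filter⁺; ∈-filter⁻; ∈-cartesianProductWith⁺)
open import Data.List.Relation.Unary.Unique.Propositional using (Unique)
import Data.List.Relation.Unary.Unique.Propositional.Properties as Unique
open import Data.Rational using (ℚ; 0ℚ; 1ℚ; _+_) renaming (_≤_ to _≤ℚ_)
import Data.Rational.Properties as ℚP
open import Data.Empty using (⊥-elim)
open import Data.Product using (Σ; _×_; _,_; proj₂; ∃)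
open import Function using (id)
open import Relation.Nullary using (¬_; yes; no; ¬?)
open import Relation.Unary using (_⊆_; _≐_)
open import Relation.Binary.PropositionalEquality
  using (_≡_; _≢_; refl; sym; trans; cong; cong₂; subst; module ≡-Reasoning)

lookup-at : ∀ {D : Set} {r ℓ} (x : Vec D r) (i : Vec (Fin r) ℓ) m
  → lookup (x at i) m ≡ lookup x (lookup i m)
lookup-at x i m = lookup-map m (lookup x) i

lookup-at-tabulate : ∀ {D : Set} {r ℓ} (x : Vec D r) (f : Fin ℓ → Fin r) m
  → lookup (x at tabulate f) m ≡ lookup x (f m)
lookup-at-tabulate x f m = trans (lookup-at x (tabulate f) m) (cong (lookup x) (lookup∘tabulate f m))

at-assoc : ∀ {D : Set} {a b c} (h : Vec D a) (t : Vec (Fin a) b) (i : Vec (Fin b) c)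
  → h at (t at i) ≡ (h at t) at i
at-assoc h t i = trans (sym (map-∘ (lookup h) (lookup t) i)) (map-cong (λ j → sym (lookup-at h t j)) i)

tabulate-id-at : ∀ {k r} (i : Vec (Fin k) r) → tabulate id at i ≡ i
tabulate-id-at i = trans (map-cong (lookup∘tabulate id) i) (map-id i)

at-tabulate-id : ∀ {D : Set} {k} (b : Vec D k) → b at tabulate id ≡ b
at-tabulate-id = map-lookup-allFin

allVecs-cartesian : ∀ n k → allVecs n (suc k) ≡ cartesianProductWith _∷_ (allFin n) (allVecs n k)
allVecs-cartesian n k = go (allFin n)
  where
  go : ∀ xs → L.concatMap (λ a → L.map (a ∷_) (allVecs n k)) xs ≡ cartesianProductWith _∷_ xs (allVecs n k)
  go []       = refl
  go (x ∷ xs) = cong (L.map (x ∷_) (allVecs n k) L.++_) (go xs)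

∈-allVecs : ∀ {n k} (v : Vec (Fin n) k) → v ∈ allVecs n k
∈-allVecs {n} []                = here refl
∈-allVecs {n} {suc k} (a ∷ v) rewrite allVecs-cartesian n k =
  ∈-cartesianProductWith⁺ _∷_ (∈-allFin a) (∈-allVecs v)

allVecs-unique : ∀ n k → Unique (allVecs n k)
allVecs-unique n zero    = All.[] ∷ []
allVecs-unique n (suc k) rewrite allVecs-cartesian n k =
  Unique.cartesianProductWith⁺ _∷_ ∷-injective (Unique.allFin⁺ n) (allVecs-unique n k)

sumℚ-map-≢0⇒ : ∀ {B : Set} (f : B → ℚ) l → sumℚ (L.map f l) ≢ 0ℚ → ∃ λ x → x ∈ l × f x ≢ 0ℚ
sumℚ-map-≢0⇒ f []      sum≢0 = ⊥-elim (sum≢0 refl)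
sumℚ-map-≢0⇒ f (x ∷ l) sum≢0 with f x ℚP.≟ 0ℚ
... | no fx≢0  = x , here refl , fx≢0
... | yes fx≡0 with sumℚ-map-≢0⇒ f l (λ rest≡0 → sum≢0 (cong₂ _+_ fx≡0 rest≡0))
...   | y , y∈l , fy≢0 = y , there y∈l , fy≢0

module _ {B : Set} {f : B → ℚ} (f≥0 : ∀ b → 0ℚ ≤ℚ f b) where

  sumℚ-map-nonneg : ∀ l → 0ℚ ≤ℚ sumℚ (L.map f l)
  sumℚ-map-nonneg []      = ℚP.≤-refl
  sumℚ-map-nonneg (x ∷ l) = ℚP.+-mono-≤ (f≥0 x) (sumℚ-map-nonneg l)

  ≤-sumℚ-map : ∀ {x} l → x ∈ l → f x ≤ℚ sumℚ (L.map f l)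
  ≤-sumℚ-map (y ∷ l) (here refl) = begin
    f y                      ≡⟨ ℚP.+-identityʳ (f y) ⟨
    f y + 0ℚ                 ≤⟨ ℚP.+-mono-≤ (ℚP.≤-refl {f y}) (sumℚ-map-nonneg l) ⟩
    f y + sumℚ (L.map f l)   ∎
    where open ℚP.≤-Reasoning
  ≤-sumℚ-map {x} (y ∷ l) (there x∈l) = begin
    f x                      ≡⟨ ℚP.+-identityˡ (f x) ⟨
    0ℚ + f x                 ≤⟨ ℚP.+-mono-≤ (f≥0 y) (≤-sumℚ-map l x∈l) ⟩
    f y + sumℚ (L.map f l)   ∎
    where open ℚP.≤-Reasoning

  sumℚ-map-≢0⇐ : ∀ {x} l → x ∈ l → f x ≢ 0ℚ → sumℚ (L.map f l) ≢ 0ℚ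
  sumℚ-map-≢0⇐ l x∈l fx≢0 sum≡0 =
    fx≢0 (ℚP.≤-antisym (subst (_ ≤ℚ_) sum≡0 (≤-sumℚ-map l x∈l)) (f≥0 _))

pointMass : ∀ {n k} → Vec (Fin n) k → Tensor n k
pointMass v b with ≡-dec _≟_ b v
... | yes _ = 1ℚ
... | no _  = 0ℚ

module _ {n k : ℕ} where

  pointMass-self : (v : Vec (Fin n) k) → pointMass v v ≡ 1ℚ
  pointMass-self v with ≡-dec _≟_ v v
  ... | yes _   = refl
  ... | no v≢v  = ⊥-elim (v≢v refl)

  pointMass-other : {v b : Vec (Fin n) k} → b ≢ v → pointMass v b ≡ 0ℚ
  pointMass-other {v} {b} b≢v with ≡-dec _≟_ b v
  ... | yes b≡v = ⊥-elim (b≢v b≡v)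
  ... | no _    = refl

  pointMass-nonneg : (v b : Vec (Fin n) k) → 0ℚ ≤ℚ pointMass v b
  pointMass-nonneg v b with ≡-dec _≟_ b v
  ... | yes _ = ℚP.nonNegative⁻¹ 1ℚ
  ... | no _  = ℚP.≤-refl

  pointMass-≢0⇒ : {v b : Vec (Fin n) k} → pointMass v b ≢ 0ℚ → b ≡ v
  pointMass-≢0⇒ {v} {b} mass≢0 with ≡-dec _≟_ b v
  ... | yes b≡v = b≡v
  ... | no _    = ⊥-elim (mass≢0 refl)

  sumℚ-pointMass-∉ : {v : Vec (Fin n) k} → ∀ l → v ∉ l → sumℚ (L.map (pointMass v) l) ≡ 0ℚ
  sumℚ-pointMass-∉ []      _   = refl
  sumℚ-pointMass-∉ (x ∷ l) v∉ rewrite pointMass-other (λ x≡v → v∉ (here (sym x≡v)))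
                                     | sumℚ-pointMass-∉ l (λ v∈l → v∉ (there v∈l)) = refl

  sumℚ-pointMass-∈ : {v : Vec (Fin n) k} → ∀ l → Unique l → v ∈ l → sumℚ (L.map (pointMass v) l) ≡ 1ℚ
  sumℚ-pointMass-∈ (x ∷ l) (x∉l ∷ _) (here refl)
    rewrite pointMass-self x | sumℚ-pointMass-∉ l (All¬⇒¬Any x∉l) = refl
  sumℚ-pointMass-∈ (x ∷ l) (x∉l ∷ l-unique) (there v∈l)
    rewrite pointMass-other (All.lookup x∉l v∈l) | sumℚ-pointMass-∈ l l-unique v∈l = refl

  sumℚ-pointMass : (v : Vec (Fin n) k) → sumℚ (L.map (pointMass v) (allVecs n k)) ≡ 1ℚ
  sumℚ-pointMass v = sumℚ-pointMass-∈ (allVecs n k) (allVecs-unique n k) (∈-allVecs v)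

fibre : ∀ {n r k} → Vec (Fin r) k → Vec (Fin n) k → List (Vec (Fin n) r)
fibre {n} {r} i a = filter (λ b → ≡-dec _≟_ (b at i) a) (allVecs n r)

marginal : ∀ {n r k} → (Vec (Fin n) r → ℚ) → Vec (Fin r) k → Tensor n k
marginal q i a = sumℚ (L.map q (fibre i a))

module _ {n r k : ℕ} {i : Vec (Fin r) k} {a : Vec (Fin n) k} where

  ∈-fibre⁺ : ∀ {b} → b at i ≡ a → b ∈ fibre i a
  ∈-fibre⁺ {b} = ∈-filter⁺ (λ c → ≡-dec _≟_ (c at i) a) (∈-allVecs b)

  ∈-fibre⁻ : ∀ {b} → b ∈ fibre i a → b at i ≡ a
  ∈-fibre⁻ b∈ = proj₂ (∈-filter⁻ (λ c → ≡-dec _≟_ (c at i) a) {xs = allVecs n r} b∈)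

  fibre-unique : Unique (fibre i a)
  fibre-unique = Unique.filter⁺ (λ c → ≡-dec _≟_ (c at i) a) (allVecs-unique n r)

module _ {n r k : ℕ} where

  marginal-pointMass : (w : Vec (Fin n) r) (i : Vec (Fin r) k) (a : Vec (Fin n) k)
    → marginal (pointMass w) i a ≡ pointMass (w at i) a
  marginal-pointMass w i a with ≡-dec _≟_ a (w at i)
  ... | yes a≡w∘i = sumℚ-pointMass-∈ _ fibre-unique (∈-fibre⁺ (sym a≡w∘i))
  ... | no a≢w∘i  = sumℚ-pointMass-∉ _ λ w∈ → a≢w∘i (sym (∈-fibre⁻ w∈))

  marginal-≢0⇒ : (q : Vec (Fin n) r → ℚ) (i : Vec (Fin r) k) (a : Vec (Fin n) k)
    → marginal q i a ≢ 0ℚ → ∃ λ b → q b ≢ 0ℚ × b at i ≡ a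
  marginal-≢0⇒ q i a marginal≢0 with sumℚ-map-≢0⇒ q _ marginal≢0
  ... | b , b∈ , qb≢0 = b , qb≢0 , ∈-fibre⁻ b∈

  marginal-≢0⇐ : {q : Vec (Fin n) r → ℚ} → (∀ b → 0ℚ ≤ℚ q b)
    → ∀ {b} → q b ≢ 0ℚ → (i : Vec (Fin r) k) → marginal q i (b at i) ≢ 0ℚ
  marginal-≢0⇐ q≥0 qb≢0 i = sumℚ-map-≢0⇐ q≥0 _ (∈-fibre⁺ refl) qb≢0

pointMass-isConvHom : ∀ {σ nX nA} k (X : Structure σ nX) (A : Structure σ nA) h
  → IsHom X A h → IsConvHom k X A (λ x → pointMass (h at x))
pointMass-isConvHom {σ} k X A h h-hom =
  (λ x → pointMass-nonneg (h at x) , sumℚ-pointMass (h at x)) , pointMass-rel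
  where
  pointMass-rel : ∀ s (t : Vec _ (ar σ s)) → t ∈ rel X s → InConvRel A k s (λ i → pointMass (h at (t at i)))
  pointMass-rel s t t∈ =
      pointMass (h at t)
    , pointMass-nonneg (h at t)
    , (λ b mass≢0 → subst (_∈ rel A s) (sym (pointMass-≢0⇒ mass≢0)) (All.lookup (h-hom s) t∈))
    , sumℚ-pointMass (h at t)
    , λ i a → begin
        pointMass (h at (t at i)) a  ≡⟨ cong (λ v → pointMass v a) (at-assoc h t i) ⟩
        pointMass ((h at t) at i) a  ≡⟨ marginal-pointMass (h at t) i a ⟨
        marginal (pointMass (h at t)) i a ∎
    where open ≡-Reasoning

-- Two coordinates of a k-projection, k ≥ 2, already see any given pair of positions j, j'.
respects-kernel : ∀ {D : Set} {k r} → 2 ≤ k → (t : Vec (Fin k) r) (b : Vec D r)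
  → (∀ (i : Vec (Fin r) k) → ∃ λ (c : Vec D k) → c at (t at i) ≡ b at i)
  → ∀ j j' → lookup t j ≡ lookup t j' → lookup b j ≡ lookup b j'
respects-kernel (s≤s (s≤s _)) t b factors j j' tj≡tj' with factors (j ∷ j' ∷ V.replicate _ j)
... | c , c∘t≡b = begin
  lookup b j              ≡⟨ ∷-injectiveˡ c∘t≡b ⟨
  lookup c (lookup t j)   ≡⟨ cong (lookup c) tj≡tj' ⟩
  lookup c (lookup t j')  ≡⟨ ∷-injectiveˡ (∷-injectiveʳ c∘t≡b) ⟩
  lookup b j'             ∎
  where open ≡-Reasoning

preimage : ∀ {k r} → Vec (Fin k) (suc r) → Fin k → Fin (suc r)
preimage t m with FinP.any? (λ j → lookup t j ≟ m)
... | yes (j , _) = j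
... | no _        = F.zero

preimage-spec : ∀ {k r} (t : Vec (Fin k) (suc r)) j → lookup t (preimage t (lookup t j)) ≡ lookup t j
preimage-spec t j with FinP.any? (λ j' → lookup t j' ≟ lookup t j)
... | yes (_ , tj'≡tj) = tj'≡tj
... | no ∄j'           = ⊥-elim (∄j' (j , refl))

support-transfer : ∀ {D : Set} {k r} → 2 ≤ k → (t : Vec (Fin k) r) {S : Vec D k → Set} {T : Vec D r → Set}
  → ∃ T
  → (∀ (i : Vec (Fin r) k) {c} → S c → ∃ λ b → T b × b at i ≡ c at (t at i))
  → (∀ (i : Vec (Fin r) k) {b} → T b → ∃ λ c → c at (t at i) ≡ b at i)
  → ∀ {h} → S h → T (h at t)
support-transfer _ [] ([] , T[]) _ _ _ = T[]
support-transfer {r = suc _} 2≤k t {T = T} _ S⇒T T-factors {h} Sh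
  with S⇒T (tabulate (preimage t)) Sh
... | b , Tb , b∘s≡h∘t∘s = subst T (Pointwise-≡⇒≡ (ext b≗h∘t)) Tb
  where
  s = tabulate (preimage t)
  b≗h∘t : ∀ j → lookup b j ≡ lookup (h at t) j
  b≗h∘t j = begin
    lookup b j                          ≡⟨ respects-kernel 2≤k t b (λ i → T-factors i Tb) j j*
                                             (sym (preimage-spec t j)) ⟩
    lookup b j*                         ≡⟨ lookup-at-tabulate b (preimage t) (lookup t j) ⟨
    lookup (b at s) (lookup t j)        ≡⟨ cong (λ v → lookup v (lookup t j))
                                             (trans b∘s≡h∘t∘s (at-assoc h t s)) ⟩
    lookup ((h at t) at s) (lookup t j) ≡⟨ lookup-at-tabulate (h at t) (preimage t) (lookup t j) ⟩
    lookup (h at t) j*                  ≡⟨ lookup-at h t j* ⟩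
    lookup h (lookup t j*)              ≡⟨ cong (lookup h) (preimage-spec t j) ⟩
    lookup h (lookup t j)               ≡⟨ lookup-at h t j ⟨
    lookup (h at t) j                   ∎
    where
    open ≡-Reasoning
    j* = preimage t (lookup t j)

marginal-support-transfer : ∀ {n k r} → 2 ≤ k → (t : Vec (Fin k) r)
  → {q : Vec (Fin n) k → ℚ} {p : Vec (Fin n) r → ℚ} → (∀ c → 0ℚ ≤ℚ q c) → (∀ b → 0ℚ ≤ℚ p b)
  → sumℚ (L.map p (allVecs n r)) ≢ 0ℚ
  → (∀ i a → marginal q (t at i) a ≡ marginal p i a)
  → ∀ {h} → q h ≢ 0ℚ → p (h at t) ≢ 0ℚ
marginal-support-transfer 2≤k t {q} {p} q≥0 p≥0 p-mass≢0 same-marginals =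
  support-transfer 2≤k t p-nonzero q⇒p p-factors
  where
  p-nonzero : ∃ λ b → p b ≢ 0ℚ
  p-nonzero with sumℚ-map-≢0⇒ p (allVecs _ _) p-mass≢0
  ... | b , _ , pb≢0 = b , pb≢0
  q⇒p : ∀ i {c} → q c ≢ 0ℚ → ∃ λ b → p b ≢ 0ℚ × b at i ≡ c at (t at i)
  q⇒p i {c} qc≢0 = marginal-≢0⇒ p i _
    (subst (_≢ 0ℚ) (same-marginals i (c at (t at i))) (marginal-≢0⇐ q≥0 qc≢0 (t at i)))
  p-factors : ∀ i {b} → p b ≢ 0ℚ → ∃ λ c → c at (t at i) ≡ b at i
  p-factors i {b} pb≢0 with marginal-≢0⇒ q (t at i) (b at i)
    (subst (_≢ 0ℚ) (sym (same-marginals i (b at i))) (marginal-≢0⇐ p≥0 pb≢0 i))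
  ... | c , _ , c∘t∘i≡b∘i = c , c∘t∘i≡b∘i

Support : ∀ {n k} → Tensor n k → Vec (Fin n) k → Set
Support T a = T a ≢ 0ℚ

module _ {σ : Signature} {k nA : ℕ} (X : Structure σ k) (A : Structure σ nA) where

  hom⊆support : ∀ {g} → MaxSupport k X A g → IsHom X A ⊆ Support (g (tabulate id))
  hom⊆support g-max {h} h-hom = g-max _ (pointMass-isConvHom k X A h h-hom) (tabulate id) h
    (subst (λ v → pointMass v h ≢ 0ℚ) (sym (at-tabulate-id h))
      (λ mass≡0 → ℚP.1≢0 (trans (sym (pointMass-self h)) mass≡0)))

  support⊆hom : 2 ≤ k → ∀ {g} → IsConvHom k X A g
    → {q : Vec (Fin nA) k → ℚ} → (∀ c → 0ℚ ≤ℚ q c) → (∀ j a → g j a ≡ marginal q j a)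
    → Support (g (tabulate id)) ⊆ IsHom X A
  support⊆hom 2≤k {g} (_ , g-rel) {q} q≥0 g≡marginal {h} gh≢0 s =
    All.tabulate λ {t} t∈ → transfer t (g-rel s t t∈)
    where
    qh≢0 : q h ≢ 0ℚ
    qh≢0 with marginal-≢0⇒ q (tabulate id) h (subst (_≢ 0ℚ) (g≡marginal (tabulate id) h) gh≢0)
    ... | c , qc≢0 , c≡h = subst (λ v → q v ≢ 0ℚ) (trans (sym (at-tabulate-id c)) c≡h) qc≢0
    transfer : ∀ {s} t → InConvRel A k s (λ i → g (t at i)) → h at t ∈ rel A s
    transfer t (p , p≥0 , p⊆R , p-mass≡1 , p-marginals) = p⊆R (h at t)
      (marginal-support-transfer 2≤k t q≥0 p≥0
        (λ p-mass≡0 → ℚP.1≢0 (trans (sym p-mass≡1) p-mass≡0))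
        (λ i a → trans (sym (g≡marginal (t at i) a)) (p-marginals i a))
        qh≢0)

  countHom≡0 : (∀ h → ¬ IsHom X A h) → countHom X A ≡ 0
  countHom≡0 ¬hom = cong length (filter-none (isHom? X A) (All.universal ¬hom (allVecs nA k)))

  countHom≡suppSize : (T : Tensor nA k) → IsHom X A ≐ Support T → countHom X A ≡ suppSize T
  countHom≡suppSize T hom≐supp =
    cong length (filter-≐ (isHom? X A) (λ a → ¬? (T a ℚP.≟ 0ℚ)) hom≐supp (allVecs nA k))

proposition5p9 : (k : ℕ) → 2 ≤ k → (σ : Signature) (nA : ℕ)
  → (X : Structure σ k) (A : Structure σ nA) → Enhanced k X A
  → ((¬ Σ (Vec (Fin k) k → Tensor nA k) (IsConvHom k X A)) → countHom X A ≡ 0)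
    × ((g : Vec (Fin k) k → Tensor nA k) → IsConvHom k X A g → MaxSupport k X A g
        → countHom X A ≡ suppSize (g (tabulate id)))
proposition5p9 .(ar σ s₀) 2≤k σ nA X A (s₀ , refl , X-full , _) =
    (λ ¬convHom → countHom≡0 X A λ h h-hom → ¬convHom (_ , pointMass-isConvHom _ X A h h-hom))
  , maxSupport⇒countHom
  where
  maxSupport⇒countHom : ∀ g → IsConvHom _ X A g → MaxSupport _ X A g → countHom X A ≡ suppSize (g (tabulate id))
  maxSupport⇒countHom g g-conv@(_ , g-rel) g-max with g-rel s₀ (tabulate id) (X-full _)
  ... | q , q≥0 , _ , _ , q-marginals = countHom≡suppSize X A (g (tabulate id))
    ( hom⊆support X A g-max
    , support⊆hom X A 2≤k g-conv q≥0
        (λ j a → subst (λ i → g i a ≡ marginal q j a) (tabulate-id-at j) (q-marginals j a)))
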